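{- There exists a countably infinite family of metagraphs $\mathcal{H}_n=\langle X_n,E_n\rangle$, $n\ge 1$, together with subsets $X'_n\subseteq X_n$, such that the number of edges $|E_n|$ grows linearly in $n$, while the number of edges of the Basu–Blanning projection of $\mathcal{H}_n$ over $X'_n$ grows quadratically in $n$ (relationships between elements of $X'_n$ that could be deduced by transitivity are each replaced by an explicit edge in the projection).
   Context: A metagraph $\mathcal{H}=\langle X,E\rangle$ consists of a finite generating set $X$ and a finite set $E$ of edges, each edge being a pair $e=\langle V_e,W_e\rangle$ with invertex $V_e\subseteq X$ and outvertex $W_e\subseteq X$. A simple path from element $x$ to element $y$ is a sequence of edges $\langle e_1,\dots,e_n\rangle$ with $x\in V_{e_1}$, $y\in W_{e_n}$ and $W_{e_i}\cap V_{e_{i+1}}\neq\emptyset$ for $i=1,\dots,n-1$. For $B,C\subseteq X$, a metapath $M(B,C)$ is a set of edges $E'\subseteq E$ such that (1) every $e\in E'$ lies on a simple path from some element of $B$ to some element of $C$, (2) $\bigcup_{e\in E'}V_e\setminus\bigcup_{e\in E'}W_e\subseteq B$, and (3) $C\subseteq\bigcup_{e\in E'}W_e$. A metapath $M(B,C)=E'$ is edge-dominant if no proper subset of $E'$ is a metapath from $B$ to $C$; it is input-dominant if there is no metapath $M'(B',C)$ with $B'\subsetneq B$; it is dominant if it is both. Given $X'\subseteq X$, a (Basu–Blanning) projection of $\mathcal{H}$ over $X'$ is a metagraph $\mathcal{H}'=\langle X',E'\rangle$ such that: (i) for every $e'=\langle V',W'\rangle\in E'$ and every $x'\in W'$ there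 is a dominant metapath $M(V',\{x'\})$ in $\mathcal{H}$; (ii) for every $x'\in X'$, if there is a dominant metapath $M(V,\{x'\})$ in $\mathcal{H}$ with $V\subseteq X'$, then there is an edge $\langle V',W'\rangle\in E'$ with $V'=V$ and $x'\in W'$; (iii) no two edges of $E'$ have the same invertex. -}

module Defs where

open import Data.Nat using (ℕ; _≤_; _*_)
open import Data.Fin using (Fin)
open import Data.Fin.Subset using (Subset; _∈_; _∉_; _⊆_; _⊂_; ⁅_⁆; _∩_; Nonempty)
open import Data.Product using (Σ; ∃; _×_; _,_; proj₁; proj₂)
open import Data.List using (List; []; _∷_)
open import Relation.Nullary using (¬_)
open import Relation.Binary.PropositionalEquality using (_≡_)
open import Function.Definitions using (Injective)

-- A metagraph ⟨X , E⟩ : generating set X = Fin nX, a finite SET of edges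
-- indexed by Fin nE (injectivity of the indexing = no repeated edges),
-- each edge a pair ⟨ V_e , W_e ⟩ of subsets of X.
record Metagraph : Set where
  field
    nX    : ℕ
    nE    : ℕ
    inV   : Fin nE → Subset nX
    outW  : Fin nE → Subset nX
    edges-distinct : Injective _≡_ _≡_ (λ e → (inV e , outW e))
open Metagraph public

module _ (H : Metagraph) where

  private
    X = Fin (nX H)
    Ed = Fin (nE H)

  -- ⟨e₁,…,eₙ⟩ (n ≥ 1, written e₁ ∷ rest) is a simple path from x to y:
  -- x ∈ V_{e₁}, consecutive edges chain (W_{eᵢ} ∩ V_{eᵢ₊₁} ≠ ∅), y ∈ W_{eₙ}.
  data PathFrom : Ed → X → Set where
    last : ∀ {e y} → y ∈ outW H e → PathFrom e y
    step : ∀ {e e' y} → Nonempty (outW H e ∩ inV H e') → PathFrom e' y → PathFrom e y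

  pathEdges : ∀ {e y} → PathFrom e y → List Ed
  pathEdges {e} (last _)   = e ∷ []
  pathEdges {e} (step _ p) = e ∷ pathEdges p

  data _∈L_ (e : Ed) : List Ed → Set where
    here  : ∀ {es} → e ∈L (e ∷ es)
    there : ∀ {e' es} → e ∈L es → e ∈L (e' ∷ es)

  record SimplePath (x y : X) : Set where
    constructor mkPath
    field
      first   : Ed
      x∈V     : x ∈ inV H first
      chain   : PathFrom first y

  onPath : ∀ {x y} → Ed → SimplePath x y → Set
  onPath e p = e ∈L pathEdges (SimplePath.chain p)

  IsMetapath : Subset (nX H) → Subset (nX H) → Subset (nE H) → Set
  IsMetapath B C E' =
    (∀ e → e ∈ E' → Σ X λ b → Σ X λ c → b ∈ B × c ∈ C ×
                      Σ (SimplePath b c) λ p → onPath e p)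
    × (∀ x → (Σ Ed λ e → e ∈ E' × x ∈ inV H e)
           → ¬ (Σ Ed λ e → e ∈ E' × x ∈ outW H e)
           → x ∈ B)
    × (∀ x → x ∈ C → Σ Ed λ e → e ∈ E' × x ∈ outW H e)

  IsEdgeDominant : Subset (nX H) → Subset (nX H) → Subset (nE H) → Set
  IsEdgeDominant B C E' =
    IsMetapath B C E' × (∀ E'' → E'' ⊂ E' → ¬ IsMetapath B C E'')

  IsInputDominant : Subset (nX H) → Subset (nX H) → Subset (nE H) → Set
  IsInputDominant B C E' =
    IsMetapath B C E' × (∀ B' → B' ⊂ B → ¬ (Σ (Subset (nE H)) λ E'' → IsMetapath B' C E''))

  IsDominant : Subset (nX H) → Subset (nX H) → Subset (nE H) → Set
  IsDominant B C E' = IsEdgeDominant B C E' × IsInputDominant B C E'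

  HasDominantMetapath : Subset (nX H) → Subset (nX H) → Set
  HasDominantMetapath B C = Σ (Subset (nE H)) λ E' → IsDominant B C E'

  record Projection (X' : Subset (nX H)) : Set where
    field
      nE'   : ℕ
      pinV  : Fin nE' → Subset (nX H)
      poutW : Fin nE' → Subset (nX H)
      pinV⊆  : ∀ e → pinV e ⊆ X'
      poutW⊆ : ∀ e → poutW e ⊆ X'
      cond-i  : ∀ e x → x ∈ poutW e → HasDominantMetapath (pinV e) ⁅ x ⁆
      cond-ii : ∀ x → x ∈ X' → ∀ V → V ⊆ X' → HasDominantMetapath V ⁅ x ⁆ →
                Σ (Fin nE') λ e → pinV e ≡ V × x ∈ poutW e
      cond-iii : Injective _≡_ _≡_ pinV
  open Projection public

{-# OPTIONS --safe #-}
-- H_n has generators d, mid s and src s i (s ∈ {0,1}, i < n) and the 2n+1 edges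
-- feed s i = ⟨{src s i},{mid s}⟩ and δ = ⟨{mid 0, mid 1},{d}⟩; X'_n omits the two middle
-- generators.  A metapath to d must use δ, each mid s must then be supplied by some feed s i,
-- and src s i, being nobody's output, must lie in the invertex.  Hence the dominant metapaths
-- inside X'_n are exactly M({src 0 i, src 1 j},{d}) for the n² pairs (i , j).  Condition (ii)
-- forces a projection edge with each of these n² invertices, and the edges ⟨{src 0 i, src 1 j},{d}⟩
-- form a projection.
module Submission where

open import Defs
open import Data.Nat using (ℕ; _≤_; _*_; _+_)
open import Data.Fin.Subset using (Subset)
open import Data.Product using (Σ; _×_)

open import Level using (0ℓ)
open import Data.Nat.Properties using (≤-trans; m≤n*m; n≤1+n; +-monoˡ-≤)
open import Data.Fin using (Fin)
open import Data.Fin.Patterns using (0F; 1F)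
import Data.Fin.Properties as Fin
open import Data.Fin.Subset using (_∈_; _∉_; _⊆_; _⊂_; ⁅_⁆)
open import Data.Fin.Subset.Properties
  using (_∈?_; _⊂?_; ⊆-antisym; ⊆-trans; ⊆-reflexive; x∈⁅x⁆; x∈⁅y⁆⇒x≡y; x∈p∩q⁺)
open import Data.Product using (∃-syntax; _,_; proj₁; proj₂)
import Data.Product.Properties as Product
open import Data.Sum using (_⊎_; inj₁; inj₂)
import Data.Sum.Properties as Sum
open import Data.Sum.Function.Propositional using (_⊎-↔_)
open import Data.Unit using (⊤; tt)
import Data.Unit.Properties as Unit
open import Data.Vec using (tabulate)
open import Data.Vec.Properties using (lookup∘tabulate; []=⇒lookup; lookup⇒[]=)
open import Data.Empty using (⊥-elim)
open import Function using (_∘_)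
open import Function.Bundles using (_↔_; Inverse; Injection)
open import Function.Construct.Composition using (_↔-∘_)
open import Function.Construct.Identity using (↔-id)
open import Function.Definitions using (Injective)
open import Function.Properties.Inverse using (↔⇒↣)
open import Relation.Binary.Definitions using (DecidableEquality)
open import Relation.Binary.PropositionalEquality
  using (_≡_; refl; sym; trans; cong; subst; module ≡-Reasoning)
open import Relation.Nullary using (¬_; yes; no; does; proof)
open import Relation.Nullary.Decidable using (_×-dec_; _⊎-dec_; dec-true; decidable-stable)
open import Relation.Nullary.Reflects using (Reflects; invert)
open import Relation.Unary using (Pred; Decidable; ∁)
open import Relation.Unary.Properties using (∁?)

module _ {H : Metagraph} {B C : Subset (nX H)} {E' : Subset (nE H)} (M : IsMetapath H B C E') where

  metapath-unproduced-input : ∀ {e x} → e ∈ E' → x ∈ inV H e → (∀ e' → x ∉ outW H e') →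
                              x ∈ B
  metapath-unproduced-input {e} {x} e∈E' x∈V unproduced =
    proj₁ (proj₂ M) x (e , e∈E' , x∈V) (λ (e' , _ , x∈W) → unproduced e' x∈W)

  metapath-input-origin : ∀ {e x} → e ∈ E' → x ∈ inV H e →
                          x ∈ B ⊎ ∃[ e' ] e' ∈ E' × x ∈ outW H e'
  metapath-input-origin {e} {x} e∈E' x∈V with Fin.any? (λ e' → (e' ∈? E') ×-dec (x ∈? outW H e'))
  ... | yes produced  = inj₂ produced
  ... | no unproduced = inj₁ (proj₁ (proj₂ M) x (e , e∈E' , x∈V) unproduced)

input-dominant-minimal : ∀ {H B C E' B' E''} → IsInputDominant H B C E' →
                         B' ⊆ B → IsMetapath H B' C E'' → B' ≡ B
input-dominant-minimal {B = B} {B' = B'} {E''} (_ , minimal) B'⊆B M' with B' ⊂? B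
... | yes B'⊂B = ⊥-elim (minimal B' B'⊂B (E'' , M'))
... | no B'⊄B  = ⊆-antisym B'⊆B B⊆B'
  where
  B⊆B' : B ⊆ B'
  B⊆B' {x} x∈B = decidable-stable (x ∈? B') (λ x∉B' → B'⊄B (B'⊆B , x , x∈B , x∉B'))

record DominantInvertices (H : Metagraph) (X' : Subset (nX H)) (k : ℕ) : Set where
  field
    target             : Fin (nX H)
    target∈X'          : target ∈ X'
    invertex           : Fin k → Subset (nX H)
    invertex-injective : Injective _≡_ _≡_ invertex
    invertex⊆X'        : ∀ p → invertex p ⊆ X'
    dominant           : ∀ p → HasDominantMetapath H (invertex p) ⁅ target ⁆
    complete           : ∀ {y W} → y ∈ X' → W ⊆ X' → HasDominantMetapath H W ⁅ y ⁆ →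
                         y ≡ target × ∃[ p ] invertex p ≡ W

module _ {H X' k} (D : DominantInvertices H X' k) where
  open DominantInvertices D

  projection-size-≥ : (P : Projection H X') → k ≤ nE' P
  projection-size-≥ P = Fin.injective⇒≤ edge-injective
    where
    edge-for : ∀ p → Σ (Fin (nE' P)) λ e → pinV P e ≡ invertex p × target ∈ poutW P e
    edge-for p = cond-ii P target target∈X' (invertex p) (invertex⊆X' p) (dominant p)

    edge-injective : Injective _≡_ _≡_ (proj₁ ∘ edge-for)
    edge-injective {p} {q} eq = invertex-injective (begin
      invertex p                    ≡⟨ sym (proj₁ (proj₂ (edge-for p))) ⟩
      pinV P (proj₁ (edge-for p))   ≡⟨ cong (pinV P) eq ⟩
      pinV P (proj₁ (edge-for q))   ≡⟨ proj₁ (proj₂ (edge-for q)) ⟩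
      invertex q                    ∎)
      where open ≡-Reasoning

  canonical-projection : Projection H X'
  canonical-projection = record
    { nE'      = k
    ; pinV     = invertex
    ; poutW    = λ _ → ⁅ target ⁆
    ; pinV⊆    = invertex⊆X'
    ; poutW⊆   = λ _ y∈ → subst (_∈ X') (sym (x∈⁅y⁆⇒x≡y target y∈)) target∈X'
    ; cond-i   = λ p y y∈ → subst (λ y → HasDominantMetapath H (invertex p) ⁅ y ⁆)
                                  (sym (x∈⁅y⁆⇒x≡y target y∈)) (dominant p)
    ; cond-ii  = λ y y∈X' W W⊆X' dom →
                   let (y≡target , p , invertex≡W) = complete y∈X' W⊆X' dom in
                   p , invertex≡W , subst (_∈ ⁅ target ⁆) (sym y≡target) (x∈⁅x⁆ target)
    ; cond-iii = invertex-injective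
    }

module Enumeration {A : Set} {N : ℕ} (enum : Fin N ↔ A) where
  open Inverse enum public using ()
    renaming ( to to decode; from to encode
             ; strictlyInverseˡ to decode-encode; strictlyInverseʳ to encode-decode)

  data Encoded : Fin N → Set where
    encoding : (a : A) → Encoded (encode a)

  encoded : ∀ x → Encoded x
  encoded x = subst Encoded (encode-decode x) (encoding (decode x))

  module _ {P : Pred A 0ℓ} where

    -- Opaque so that P? can be recovered by unification from a subset ⟦ P? ⟧.
    opaque
      ⟦_⟧ : Decidable P → Subset N
      ⟦ P? ⟧ = tabulate (does ∘ P? ∘ decode)

      encode∈⟦⟧⁺ : ∀ {P? a} → P a → encode a ∈ ⟦ P? ⟧
      encode∈⟦⟧⁺ {P?} {a} pa = lookup⇒[]= (encode a) _
        (trans (lookup∘tabulate _ (encode a))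
               (dec-true (P? (decode (encode a))) (subst P (sym (decode-encode a)) pa)))

      encode∈⟦⟧⁻ : ∀ {P? a} → encode a ∈ ⟦ P? ⟧ → P a
      encode∈⟦⟧⁻ {P?} {a} a∈ = subst P (decode-encode a)
        (invert (subst (Reflects _) (trans (sym (lookup∘tabulate _ (encode a))) ([]=⇒lookup a∈))
                       (proof (P? (decode (encode a))))))

    ⟦⟧⊆ : ∀ {P? S} → (∀ {a} → P a → encode a ∈ S) → ⟦ P? ⟧ ⊆ S
    ⟦⟧⊆ P⊆S {x} x∈ with encoded x
    ... | encoding a = P⊆S (encode∈⟦⟧⁻ x∈)


Side : Set
Side = Fin 2

Generator : ℕ → Set
Generator n = ⊤ ⊎ (Side ⊎ Side × Fin n)

pattern d       = inj₁ tt
pattern mid s   = inj₂ (inj₁ s)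
pattern src s i = inj₂ (inj₂ (s , i))

Edge : ℕ → Set
Edge n = ⊤ ⊎ Side × Fin n

pattern δ        = inj₁ tt
pattern feed s i = inj₂ (s , i)

module Construction (n : ℕ) where

  _≟ᴳ_ : DecidableEquality (Generator n)
  _≟ᴳ_ = Sum.≡-dec Unit._≟_ (Sum.≡-dec Fin._≟_ (Product.≡-dec Fin._≟_ Fin._≟_))

  _≟ᴱ_ : DecidableEquality (Edge n)
  _≟ᴱ_ = Sum.≡-dec Unit._≟_ (Product.≡-dec Fin._≟_ Fin._≟_)

  Middle : Pred (Generator n) 0ℓ
  Middle x = ∃[ s ] x ≡ mid s

  middle? : Decidable Middle
  middle? x = Fin.any? (λ s → x ≟ᴳ mid s)

  Invertex Outvertex : Edge n → Pred (Generator n) 0ℓ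
  Invertex δ          x = Middle x
  Invertex (feed s i) x = x ≡ src s i
  Outvertex δ          x = x ≡ d
  Outvertex (feed s i) x = x ≡ mid s

  invertex? : ∀ ε → Decidable (Invertex ε)
  invertex? δ          = middle?
  invertex? (feed s i) = _≟ᴳ src s i

  outvertex? : ∀ ε → Decidable (Outvertex ε)
  outvertex? δ          = _≟ᴳ d
  outvertex? (feed s i) = _≟ᴳ mid s

  -- Opaque: unfolding these into splitAt/remQuot terms makes unification with encoded elements
  -- very slow.
  opaque
    generators : Fin (1 + (2 + 2 * n)) ↔ Generator n
    generators = (Fin.1↔⊤ ⊎-↔ ((↔-id _ ⊎-↔ Fin.*↔×) ↔-∘ Fin.+↔⊎)) ↔-∘ Fin.+↔⊎

    edges : Fin (1 + 2 * n) ↔ Edge n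
    edges = (Fin.1↔⊤ ⊎-↔ Fin.*↔×) ↔-∘ Fin.+↔⊎

  module G = Enumeration generators
  module E = Enumeration edges

  inputs outputs : Fin (1 + 2 * n) → Subset (1 + (2 + 2 * n))
  inputs  e = G.⟦ invertex?  (E.decode e) ⟧
  outputs e = G.⟦ outvertex? (E.decode e) ⟧

  ∈inputs⁺ : ∀ {ε x} → Invertex ε x → G.encode x ∈ inputs (E.encode ε)
  ∈inputs⁺ {ε} {x} = G.encode∈⟦⟧⁺ ∘ subst (λ ε → Invertex ε x) (sym (E.decode-encode ε))

  ∈inputs⁻ : ∀ {ε x} → G.encode x ∈ inputs (E.encode ε) → Invertex ε x
  ∈inputs⁻ {ε} {x} = subst (λ ε → Invertex ε x) (E.decode-encode ε) ∘ G.encode∈⟦⟧⁻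

  ∈outputs⁺ : ∀ {ε x} → Outvertex ε x → G.encode x ∈ outputs (E.encode ε)
  ∈outputs⁺ {ε} {x} = G.encode∈⟦⟧⁺ ∘ subst (λ ε → Outvertex ε x) (sym (E.decode-encode ε))

  ∈outputs⁻ : ∀ {ε x} → G.encode x ∈ outputs (E.encode ε) → Outvertex ε x
  ∈outputs⁻ {ε} {x} = subst (λ ε → Outvertex ε x) (E.decode-encode ε) ∘ G.encode∈⟦⟧⁻

  representative : Edge n → Generator n
  representative δ          = mid 0F
  representative (feed s i) = src s i

  representative-invertex : ∀ ε → Invertex ε (representative ε)
  representative-invertex δ          = 0F , refl
  representative-invertex (feed s i) = refl

  representative-determines : ∀ ε {ε'} → Invertex ε' (representative ε) → ε ≡ ε'
  representative-determines δ          {δ}        _    = refl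
  representative-determines (feed s i) {feed s i} refl = refl

  inputs-injective : Injective _≡_ _≡_ inputs
  inputs-injective {e} {e'} eq with E.encoded e | E.encoded e'
  ... | E.encoding ε | E.encoding ε' = cong E.encode (representative-determines ε (∈inputs⁻ rep∈))
    where
    rep∈ : G.encode (representative ε) ∈ inputs (E.encode ε')
    rep∈ = subst (G.encode (representative ε) ∈_) eq (∈inputs⁺ (representative-invertex ε))

  H : Metagraph
  H = record
    { nX = 1 + (2 + 2 * n)
    ; nE = 1 + 2 * n
    ; inV = inputs
    ; outW = outputs
    ; edges-distinct = λ eq → inputs-injective (cong proj₁ eq)
    }

  X' : Subset (nX H)
  X' = G.⟦ ∁? middle? ⟧

  target : Fin (nX H)
  target = G.encode d

  mid∉X' : ∀ s → G.encode (mid s) ∉ X'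
  mid∉X' s mid∈X' = G.encode∈⟦⟧⁻ mid∈X' (s , refl)

  feed-path : ∀ s i → SimplePath H (G.encode (src s i)) target
  feed-path s i = mkPath (E.encode (feed s i)) (∈inputs⁺ refl)
    (step (G.encode (mid s) , x∈p∩q⁺ (∈outputs⁺ refl , ∈inputs⁺ (s , refl)))
          (last (∈outputs⁺ refl)))

  only-δ-outputs-d : ∀ ε → Outvertex ε d → ε ≡ δ
  only-δ-outputs-d δ refl = refl

  outputs-of-mid : ∀ ε {s} → Outvertex ε (mid s) → ∃[ i ] ε ≡ feed s i
  outputs-of-mid (feed s i) refl = i , refl

  src-not-output : ∀ ε {s i} → ¬ Outvertex ε (src s i)
  src-not-output δ          ()
  src-not-output (feed _ _) ()

  src-unproduced : ∀ {s i} e → G.encode (src s i) ∉ outputs e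
  src-unproduced e src∈ with E.encoded e
  ... | E.encoding ε = src-not-output ε (∈outputs⁻ src∈)

  non-middle-output-is-d : ∀ ε {x} → Outvertex ε x → ∁ Middle x → x ≡ d
  non-middle-output-is-d δ          refl _       = refl
  non-middle-output-is-d (feed s _) refl ¬middle = ⊥-elim (¬middle (s , refl))

  module _ {B : Subset (nX H)} {E' : Subset (nE H)} (M : IsMetapath H B ⁅ target ⁆ E') where

    δ-used : E.encode δ ∈ E'
    δ-used with proj₂ (proj₂ M) target (x∈⁅x⁆ target)
    ... | e , e∈E' , d∈ with E.encoded e
    ...   | E.encoding ε = subst (_∈ E') (cong E.encode (only-δ-outputs-d ε (∈outputs⁻ d∈))) e∈E'

    middle-supplied : ∀ s → G.encode (mid s) ∈ B ⊎
                      ∃[ i ] G.encode (src s i) ∈ B × E.encode (feed s i) ∈ E'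
    middle-supplied s with metapath-input-origin M δ-used (∈inputs⁺ (s , refl))
    ... | inj₁ mid∈B = inj₁ mid∈B
    ... | inj₂ (e , e∈E' , mid∈) with E.encoded e
    ...   | E.encoding ε with outputs-of-mid ε (∈outputs⁻ mid∈)
    ...     | i , refl =
      inj₂ (i , metapath-unproduced-input M e∈E' (∈inputs⁺ refl) src-unproduced , e∈E')

  Pair : Set
  Pair = Fin n × Fin n

  select : Side → Pair → Fin n
  select 0F = proj₁
  select 1F = proj₂

  Sources : Pair → Pred (Generator n) 0ℓ
  Sources p x = ∃[ s ] x ≡ src s (select s p)

  Route : Pair → Pred (Edge n) 0ℓ
  Route p ε = ε ≡ δ ⊎ ∃[ s ] ε ≡ feed s (select s p)

  sources? : ∀ p → Decidable (Sources p)
  sources? p x = Fin.any? (λ s → x ≟ᴳ src s (select s p))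

  route? : ∀ p → Decidable (Route p)
  route? p ε = (ε ≟ᴱ δ) ⊎-dec Fin.any? (λ s → ε ≟ᴱ feed s (select s p))

  sources : Pair → Subset (nX H)
  sources p = G.⟦ sources? p ⟧

  route : Pair → Subset (nE H)
  route p = E.⟦ route? p ⟧

  src∈sources : ∀ {p} s → G.encode (src s (select s p)) ∈ sources p
  src∈sources s = G.encode∈⟦⟧⁺ (s , refl)

  src∈sources⁻ : ∀ {p s i} → G.encode (src s i) ∈ sources p → i ≡ select s p
  src∈sources⁻ src∈ with G.encode∈⟦⟧⁻ src∈
  ... | _ , refl = refl

  mid∉sources : ∀ {p} s → G.encode (mid s) ∉ sources p
  mid∉sources s mid∈ with G.encode∈⟦⟧⁻ mid∈
  ... | _ , ()

  sources⊆X' : ∀ p → sources p ⊆ X'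
  sources⊆X' p = G.⟦⟧⊆ λ { (_ , refl) → G.encode∈⟦⟧⁺ λ { (_ , ()) } }

  sources-⊆-injective : ∀ {p q} → sources p ⊆ sources q → p ≡ q
  sources-⊆-injective p⊆q = Product.×-≡,≡→≡
    (src∈sources⁻ (p⊆q (src∈sources 0F)) , src∈sources⁻ (p⊆q (src∈sources 1F)))

  metapath-selects-pair : ∀ {B E'} → IsMetapath H B ⁅ target ⁆ E' →
                          (∀ s → G.encode (mid s) ∉ B) →
                          ∃[ p ] sources p ⊆ B × route p ⊆ E'
  metapath-selects-pair {B} {E'} M mid∉B = p , G.⟦⟧⊆ src∈B , E.⟦⟧⊆ on-route
    where
    fed : ∀ s → ∃[ i ] G.encode (src s i) ∈ B × E.encode (feed s i) ∈ E'
    fed s with middle-supplied M s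
    ... | inj₁ mid∈B = ⊥-elim (mid∉B s mid∈B)
    ... | inj₂ fed-s = fed-s

    p : Pair
    p = proj₁ (fed 0F) , proj₁ (fed 1F)

    fed-p : ∀ s → G.encode (src s (select s p)) ∈ B × E.encode (feed s (select s p)) ∈ E'
    fed-p 0F = proj₂ (fed 0F)
    fed-p 1F = proj₂ (fed 1F)

    src∈B : ∀ {x} → Sources p x → G.encode x ∈ B
    src∈B (s , refl) = proj₁ (fed-p s)

    on-route : ∀ {ε} → Route p ε → E.encode ε ∈ E'
    on-route (inj₁ refl)       = δ-used M
    on-route (inj₂ (s , refl)) = proj₂ (fed-p s)

  metapath-within-sources : ∀ {p B E'} → B ⊆ sources p → IsMetapath H B ⁅ target ⁆ E' →
                            sources p ⊆ B × route p ⊆ E'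
  metapath-within-sources {p} {B} {E'} B⊆ M =
    let (q , q⊆B , route⊆E') = metapath-selects-pair M (λ s → mid∉sources s ∘ B⊆) in
    subst (λ q → sources q ⊆ B × route q ⊆ E') (sources-⊆-injective (⊆-trans q⊆B B⊆))
          (q⊆B , route⊆E')

  route-metapath : ∀ p → IsMetapath H (sources p) ⁅ target ⁆ (route p)
  route-metapath p = on-path , unproduced∈sources , target-produced
    where
    target-produced : ∀ y → y ∈ ⁅ target ⁆ →
                      Σ (Fin (nE H)) λ e → e ∈ route p × y ∈ outputs e
    target-produced y y∈ = E.encode δ , E.encode∈⟦⟧⁺ (inj₁ refl) ,
      subst (_∈ outputs (E.encode δ)) (sym (x∈⁅y⁆⇒x≡y target y∈)) (∈outputs⁺ refl)

    on-path : ∀ e → e ∈ route p → Σ (Fin (nX H)) λ b → Σ (Fin (nX H)) λ c →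
              b ∈ sources p × c ∈ ⁅ target ⁆ × Σ (SimplePath H b c) λ path → onPath H e path
    on-path e e∈ with E.encoded e
    ... | E.encoding ε with E.encode∈⟦⟧⁻ e∈
    ...   | inj₁ refl       = _ , _ , src∈sources 0F , x∈⁅x⁆ target , feed-path 0F _ , there here
    ...   | inj₂ (s , refl) = _ , _ , src∈sources s , x∈⁅x⁆ target , feed-path s _ , here

    unproduced∈sources : ∀ x → (Σ (Fin (nE H)) λ e → e ∈ route p × x ∈ inputs e) →
                         ¬ (Σ (Fin (nE H)) λ e → e ∈ route p × x ∈ outputs e) → x ∈ sources p
    unproduced∈sources x (e , e∈ , x∈) unproduced with E.encoded e | G.encoded x
    ... | E.encoding ε | G.encoding a with E.encode∈⟦⟧⁻ e∈ | ∈inputs⁻ x∈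
    ...   | inj₁ refl       | s , refl = ⊥-elim (unproduced (E.encode (feed s (select s p)) ,
                                            E.encode∈⟦⟧⁺ (inj₂ (s , refl)) , ∈outputs⁺ refl))
    ...   | inj₂ (s , refl) | refl     = src∈sources s

  route-dominant : ∀ p → IsDominant H (sources p) ⁅ target ⁆ (route p)
  route-dominant p = (route-metapath p , edge-minimal) , (route-metapath p , input-minimal)
    where
    edge-minimal : ∀ E'' → E'' ⊂ route p → ¬ IsMetapath H (sources p) ⁅ target ⁆ E''
    edge-minimal E'' (_ , _ , e∈ , e∉E'') M =
      e∉E'' (proj₂ (metapath-within-sources (λ x∈ → x∈) M) e∈)

    input-minimal : ∀ B' → B' ⊂ sources p →
                    ¬ (Σ (Subset (nE H)) λ E'' → IsMetapath H B' ⁅ target ⁆ E'')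
    input-minimal B' (B'⊆ , _ , x∈ , x∉B') (_ , M) =
      x∉B' (proj₁ (metapath-within-sources B'⊆ M) x∈)

  metapath-target : ∀ {y B E'} → y ∈ X' → IsMetapath H B ⁅ y ⁆ E' → y ≡ target
  metapath-target {y} y∈X' M with proj₂ (proj₂ M) y (x∈⁅x⁆ y)
  ... | e , _ , y∈ with E.encoded e | G.encoded y
  ...   | E.encoding ε | G.encoding x =
    cong G.encode (non-middle-output-is-d ε (∈outputs⁻ y∈) (G.encode∈⟦⟧⁻ y∈X'))

  dominant-invertex : ∀ {W} → W ⊆ X' → HasDominantMetapath H W ⁅ target ⁆ →
                      ∃[ p ] sources p ≡ W
  dominant-invertex W⊆X' (_ , (M , _) , input-dominant) =
    let (p , p⊆W , _) = metapath-selects-pair M (λ s → mid∉X' s ∘ W⊆X') in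
    p , input-dominant-minimal input-dominant p⊆W (route-metapath p)

  pair : Fin (n * n) → Pair
  pair = Inverse.to Fin.*↔×

  dominant-invertices : DominantInvertices H X' (n * n)
  dominant-invertices = record
    { target             = target
    ; target∈X'          = G.encode∈⟦⟧⁺ λ { (_ , ()) }
    ; invertex           = sources ∘ pair
    ; invertex-injective = λ eq →
        Injection.injective (↔⇒↣ Fin.*↔×) (sources-⊆-injective (⊆-reflexive eq))
    ; invertex⊆X'        = sources⊆X' ∘ pair
    ; dominant           = λ k → route (pair k) , route-dominant (pair k)
    ; complete           = complete
    }
    where
    complete : ∀ {y W} → y ∈ X' → W ⊆ X' → HasDominantMetapath H W ⁅ y ⁆ →
               y ≡ target × ∃[ k ] sources (pair k) ≡ W
    complete {W = W} y∈X' W⊆X' dom@(_ , (M , _) , _) =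
      let y≡target        = metapath-target y∈X' M
          (p , sources≡W) = dominant-invertex W⊆X'
                              (subst (λ y → HasDominantMetapath H W ⁅ y ⁆) y≡target dom)
      in y≡target , Inverse.from Fin.*↔× p ,
         trans (cong sources (Inverse.strictlyInverseˡ Fin.*↔× p)) sources≡W

lemma1 : Σ (ℕ → Metagraph) λ H →
           Σ ((n : ℕ) → Subset (nX (H n))) λ X' →
           Σ ℕ λ a → Σ ℕ λ A → Σ ℕ λ b → Σ ℕ λ B →
           ((n : ℕ) → 1 ≤ n →
             -- |E_n| = Θ(n)
             (n ≤ a * nE (H n)) × (nE (H n) ≤ A * n)
             -- every projection of H_n over X'_n has Ω(n²) edges ...
             × ((P : Projection (H n) (X' n)) → n * n ≤ b * nE' P)
             -- ... and a projection with O(n²) edges exists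
             × Σ (Projection (H n) (X' n)) λ P → nE' P ≤ B * (n * n))
lemma1 = Construction.H , Construction.X' , 1 , 3 , 1 , 1 , λ n 1≤n →
  let open Construction n in
  ≤-trans (≤-trans (m≤n*m n 2) (n≤1+n (2 * n))) (m≤n*m _ 1) ,
  +-monoˡ-≤ (2 * n) 1≤n ,
  (λ P → ≤-trans (projection-size-≥ dominant-invertices P) (m≤n*m _ 1)) ,
  canonical-projection dominant-invertices , m≤n*m (n * n) 1
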